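{- The CNF formula $G(x_1,\ldots,x_9)=(\overline{x}_1+\overline{x}_2+\overline{x}_3)\wedge(\overline{x}_1+x_2+x_7)\wedge(\overline{x}_2+x_3+x_8)\wedge(\overline{x}_3+x_1+x_9)\wedge(\overline{x}_4+x_1+x_7)\wedge(\overline{x}_5+x_2+x_8)\wedge(\overline{x}_6+x_3+x_9)\wedge(\overline{x}_7+x_5+x_8)\wedge(\overline{x}_8+x_6+x_9)\wedge(\overline{x}_9+x_4+x_7)\wedge(\overline{x}_1+\overline{x}_4+\overline{x}_9)\wedge(\overline{x}_2+\overline{x}_5+\overline{x}_7)\wedge(\overline{x}_3+\overline{x}_6+\overline{x}_8)\wedge(\overline{x}_7+\overline{x}_8+\overline{x}_9)$ is planar and has exactly one satisfying assignment, namely the assignment $\mathbf v$ with $\mathbf v[x_i]=0$ for $1\le i\le 9$.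
   Context: $+$ denotes disjunction, $\wedge$ conjunction, $\overline{x}$ negation. The bipartite graph of a CNF formula has one vertex per variable and one per clause, with an edge between a clause and a variable iff the variable (negated or unnegated) occurs in the clause; the formula is planar iff this graph is planar. -}

module Defs where

open import Data.Nat using (ℕ)
open import Data.Fin using (Fin; zero; suc) renaming (#_ to #F_)
open import Data.Bool using (Bool; true; false; not)
open import Data.List using (List; []; _∷_; length; lookup)
open import Data.List.Relation.Unary.All using (All)
open import Data.List.Relation.Unary.Any using (Any)
open import Data.Vec as Vec using (Vec)
open import Data.Integer using (ℤ; _-_; _*_; _<_; _≤_; _⊓_; _⊔_; 0ℤ)
open import Data.Product using (_×_; _,_; proj₁; proj₂; ∃-syntax)
open import Data.Sum using (_⊎_; inj₁; inj₂)
open import Relation.Binary.PropositionalEquality using (_≡_)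
open import Relation.Nullary using (¬_)

-- CNF formulas over variables Fin n  (variable x_{i+1} is index i)

data Literal (n : ℕ) : Set where
  pos : Fin n → Literal n
  neg : Fin n → Literal n

var : ∀ {n} → Literal n → Fin n
var (pos i) = i
var (neg i) = i

Clause : ℕ → Set
Clause n = List (Literal n)

CNF : ℕ → Set
CNF n = List (Clause n)

Assignment : ℕ → Set
Assignment n = Vec Bool n

evalLit : ∀ {n} → Assignment n → Literal n → Bool
evalLit a (pos i) = Vec.lookup a i
evalLit a (neg i) = not (Vec.lookup a i)

SatClause : ∀ {n} → Assignment n → Clause n → Set
SatClause a C = Any (λ l → evalLit a l ≡ true) C

Satisfies : ∀ {n} → Assignment n → CNF n → Set
Satisfies a F = All (SatClause a) F

-- Bipartite variable/clause graph of a CNF formula.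
-- Vertices: Fin n (variables) ⊎ Fin (length F) (clauses).
-- Edge between clause c and variable v iff v occurs (negated or not) in c.

Vertex : ∀ {n} → CNF n → Set
Vertex {n} F = Fin n ⊎ Fin (length F)

Occurs : ∀ {n} (F : CNF n) → Fin (length F) → Fin n → Set
Occurs F c v = Any (λ l → var l ≡ v) (lookup F c)

Point : Set
Point = ℤ × ℤ

-- twice the signed area of the triangle p q r
orient : Point → Point → Point → ℤ
orient (px , py) (qx , qy) (rx , ry) =
  ((qx - px) * (ry - py)) - ((qy - py) * (rx - px))

OnSegment : Point → Point → Point → Set
OnSegment p q r =
  orient p q r ≡ 0ℤ
  × ((proj₁ p ⊓ proj₁ q) ≤ proj₁ r × proj₁ r ≤ (proj₁ p ⊔ proj₁ q))
  × ((proj₂ p ⊓ proj₂ q) ≤ proj₂ r × proj₂ r ≤ (proj₂ p ⊔ proj₂ q))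

-- the closed segments [p,q] and [r,s] have a common point
-- (standard exact criterion: proper crossing, or an endpoint on the other segment)
SegmentsIntersect : Point → Point → Point → Point → Set
SegmentsIntersect p q r s =
  ((orient p q r * orient p q s) < 0ℤ × (orient r s p * orient r s q) < 0ℤ)
  ⊎ OnSegment p q r ⊎ OnSegment p q s ⊎ OnSegment r s p ⊎ OnSegment r s q

-- Planarity of the bipartite graph of F, as existence of a plane
-- straight-line drawing (equivalent to planarity by Fáry's theorem;
-- rational coordinates can be scaled to integer ones).
--  * distinct vertices get distinct points;
--  * no vertex lies on an edge it is not an endpoint of;
--  * two edges without a common endpoint do not meet.
-- (Two edges with a common endpoint then meet only there.)

record StraightLineEmbedding {n} (F : CNF n) : Set where
  field
    place       : Vertex F → Point
    injective   : ∀ u w → place u ≡ place w → u ≡ w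
    vertexOffEdge : ∀ c v → Occurs F c v → ∀ (w : Vertex F) →
                    ¬ (w ≡ inj₁ v) → ¬ (w ≡ inj₂ c) →
                    ¬ OnSegment (place (inj₂ c)) (place (inj₁ v)) (place w)
    edgesDisjoint : ∀ c v c′ v′ → Occurs F c v → Occurs F c′ v′ →
                    ¬ (c ≡ c′) → ¬ (v ≡ v′) →
                    ¬ SegmentsIntersect (place (inj₂ c)) (place (inj₁ v))
                                        (place (inj₂ c′)) (place (inj₁ v′))

Planar : ∀ {n} → CNF n → Set
Planar F = StraightLineEmbedding F

private
  x : ℕ → Fin 9
  x 1 = zero
  x 2 = suc zero
  x 3 = suc (suc zero)
  x 4 = suc (suc (suc zero))
  x 5 = suc (suc (suc (suc zero)))
  x 6 = suc (suc (suc (suc (suc zero))))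
  x 7 = suc (suc (suc (suc (suc (suc zero)))))
  x 8 = suc (suc (suc (suc (suc (suc (suc zero))))))
  x _ = suc (suc (suc (suc (suc (suc (suc (suc zero)))))))   -- x 9

  P N : ℕ → Literal 9
  P i = pos (x i)
  N i = neg (x i)

G : CNF 9
G = (N 1 ∷ N 2 ∷ N 3 ∷ [])
  ∷ (N 1 ∷ P 2 ∷ P 7 ∷ [])
  ∷ (N 2 ∷ P 3 ∷ P 8 ∷ [])
  ∷ (N 3 ∷ P 1 ∷ P 9 ∷ [])
  ∷ (N 4 ∷ P 1 ∷ P 7 ∷ [])
  ∷ (N 5 ∷ P 2 ∷ P 8 ∷ [])
  ∷ (N 6 ∷ P 3 ∷ P 9 ∷ [])
  ∷ (N 7 ∷ P 5 ∷ P 8 ∷ [])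
  ∷ (N 8 ∷ P 6 ∷ P 9 ∷ [])
  ∷ (N 9 ∷ P 4 ∷ P 7 ∷ [])
  ∷ (N 1 ∷ N 4 ∷ N 9 ∷ [])
  ∷ (N 2 ∷ N 5 ∷ N 7 ∷ [])
  ∷ (N 3 ∷ N 6 ∷ N 8 ∷ [])
  ∷ (N 7 ∷ N 8 ∷ N 9 ∷ [])
  ∷ []

{-# OPTIONS --safe #-}
-- Both halves are finite checks run by the type checker: uniqueness by
-- testing all 2⁹ assignments, planarity by exhibiting a straight-line drawing
-- with integer coordinates and testing every vertex/edge and edge/edge pair
-- with the exact orientation predicate.
module Submission where

open import Defs
open import Data.Bool using (false; true)
open import Data.Vec using (replicate)
open import Data.Product using (_×_)
open import Relation.Binary.PropositionalEquality using (_≡_)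
open import Function.Bundles using (_⇔_)

import Data.Bool.Properties as Bool
import Data.Fin.Properties as Fin
open import Data.Fin.Subset.Properties using (anySubset?)
open import Data.Integer using (+_; -_; _*_; _⊓_; _⊔_; 0ℤ)
import Data.Integer.Properties as ℤ
open import Data.List using (length; lookup)
open import Data.List.Relation.Unary.All using (all?)
open import Data.List.Relation.Unary.Any using (any?)
open import Data.Product using (_,_; ∃-syntax)
import Data.Product.Properties as Product
open import Data.Sum using (_⊎_; inj₁; inj₂; [_,_])
import Data.Sum.Properties as Sum
open import Data.Vec using (Vec; []; _∷_)
import Data.Vec.Properties as Vec
open import Function.Base using (_∘_)
open import Function.Bundles using (mk⇔)
open import Relation.Binary.PropositionalEquality using (refl; _≢_)
open import Relation.Nullary using (Dec; ¬_)
open import Relation.Nullary.Decidable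
  using (True; toWitness; from-yes; from-no; decidable-stable; map′; ¬?; _×-dec_; _⊎-dec_; _→-dec_)
open import Relation.Unary using (Pred; Decidable)

satisfies? : ∀ {n} (a : Assignment n) (F : CNF n) → Dec (Satisfies a F)
satisfies? a = all? (any? (λ l → evalLit a l Bool.≟ true))

satisfies⇔≡ : ∀ {n} {F : CNF n} {a₀ : Assignment n} →
              Satisfies a₀ F → ¬ (∃[ a ] Satisfies a F × a ≢ a₀) →
              ∀ a → Satisfies a F ⇔ a ≡ a₀
satisfies⇔≡ {a₀ = a₀} sat₀ noOther a = mk⇔
  (λ sat → decidable-stable (Vec.≡-dec Bool._≟_ a a₀) (λ a≢a₀ → noOther (a , sat , a≢a₀)))
  (λ { refl → sat₀ })

onSegment? : ∀ p q r → Dec (OnSegment p q r)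
onSegment? p@(px , py) q@(qx , qy) r@(rx , ry) =
  orient p q r ℤ.≟ 0ℤ
  ×-dec ((px ⊓ qx) ℤ.≤? rx ×-dec rx ℤ.≤? (px ⊔ qx))
  ×-dec ((py ⊓ qy) ℤ.≤? ry ×-dec ry ℤ.≤? (py ⊔ qy))

segmentsIntersect? : ∀ p q r s → Dec (SegmentsIntersect p q r s)
segmentsIntersect? p q r s =
  ((orient p q r * orient p q s) ℤ.<? 0ℤ ×-dec (orient r s p * orient r s q) ℤ.<? 0ℤ)
  ⊎-dec onSegment? p q r ⊎-dec onSegment? p q s ⊎-dec onSegment? r s p ⊎-dec onSegment? r s q

occurs? : ∀ {n} (F : CNF n) c v → Dec (Occurs F c v)
occurs? F c v = any? (λ l → var l Fin.≟ v) (lookup F c)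

all-⊎? : ∀ {a b p} {A : Set a} {B : Set b} {P : Pred (A ⊎ B) p} →
         Dec (∀ x → P (inj₁ x)) → Dec (∀ y → P (inj₂ y)) → Dec (∀ z → P z)
all-⊎? p? q? = map′ (λ (f , g) → [ f , g ]) (λ h → h ∘ inj₁ , h ∘ inj₂) (p? ×-dec q?)

module _ {n} (F : CNF n) where

  allVertices? : ∀ {p} {P : Pred (Vertex F) p} → Decidable P → Dec (∀ u → P u)
  allVertices? P? = all-⊎? (Fin.all? (P? ∘ inj₁)) (Fin.all? (P? ∘ inj₂))

  _≟ᵛ_ : (u w : Vertex F) → Dec (u ≡ w)
  _≟ᵛ_ = Sum.≡-dec Fin._≟_ Fin._≟_

  module _ (place : Vertex F → Point) where

    injective? : Dec (∀ u w → place u ≡ place w → u ≡ w)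
    injective? = allVertices? λ u → allVertices? λ w →
      Product.≡-dec ℤ._≟_ ℤ._≟_ (place u) (place w) →-dec u ≟ᵛ w

    vertexOffEdge? : Dec (∀ c v → Occurs F c v → ∀ (w : Vertex F) →
                          ¬ (w ≡ inj₁ v) → ¬ (w ≡ inj₂ c) →
                          ¬ OnSegment (place (inj₂ c)) (place (inj₁ v)) (place w))
    vertexOffEdge? = Fin.all? λ c → Fin.all? λ v → occurs? F c v →-dec allVertices? λ w →
      ¬? (w ≟ᵛ inj₁ v) →-dec ¬? (w ≟ᵛ inj₂ c) →-dec
      ¬? (onSegment? (place (inj₂ c)) (place (inj₁ v)) (place w))

    edgesDisjoint? : Dec (∀ c v c′ v′ → Occurs F c v → Occurs F c′ v′ →
                          ¬ (c ≡ c′) → ¬ (v ≡ v′) →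
                          ¬ SegmentsIntersect (place (inj₂ c)) (place (inj₁ v))
                                              (place (inj₂ c′)) (place (inj₁ v′)))
    edgesDisjoint? = Fin.all? λ c → Fin.all? λ v → Fin.all? λ c′ → Fin.all? λ v′ →
      occurs? F c v →-dec occurs? F c′ v′ →-dec ¬? (c Fin.≟ c′) →-dec ¬? (v Fin.≟ v′) →-dec
      ¬? (segmentsIntersect? (place (inj₂ c)) (place (inj₁ v)) (place (inj₂ c′)) (place (inj₁ v′)))

    straightLineEmbedding : {_ : True injective?} {_ : True vertexOffEdge?}
                            {_ : True edgesDisjoint?} → StraightLineEmbedding F
    straightLineEmbedding {inj} {off} {disj} = record
      { place         = place
      ; injective     = toWitness inj
      ; vertexOffEdge = toWitness off
      ; edgesDisjoint = toWitness disj
      }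

-- An assignment is the subset of variables it makes true, so the library's
-- search over subsets enumerates assignments.
onlyModelOfG : ¬ (∃[ a ] Satisfies a G × a ≢ replicate 9 false)
onlyModelOfG = from-no (anySubset? λ a →
  satisfies? a G ×-dec ¬? (Vec.≡-dec Bool._≟_ a (replicate 9 false)))

variablePoints : Vec Point 9
variablePoints =
  (+ 299 , + 0)      ∷ (+ 0 , + 1000)     ∷ (+ 0 , - + 1000)   ∷
  (+ 111 , + 0)      ∷ (- + 78 , + 400)   ∷ (- + 78 , - + 400) ∷
  (+ 16 , + 200)     ∷ (- + 250 , + 0)    ∷ (+ 16 , - + 200)   ∷ []

clausePoints : Vec Point (length G)
clausePoints =
  (+ 1000 , + 0)      ∷ (+ 105 , + 400)     ∷ (- + 1000 , + 0)    ∷ (+ 105 , - + 400)   ∷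
  (+ 142 , + 67)      ∷ (- + 109 , + 467)   ∷ (- + 20 , - + 533)  ∷ (- + 104 , + 200)   ∷
  (- + 104 , - + 200) ∷ (+ 48 , + 0)        ∷ (+ 142 , - + 67)    ∷ (- + 20 , + 533)    ∷
  (- + 109 , - + 467) ∷ (- + 72 , + 0)      ∷ []

drawingOfG : Vertex G → Point
drawingOfG = [ Data.Vec.lookup variablePoints , Data.Vec.lookup clausePoints ]

lemma3p7 : Planar G × (∀ a → Satisfies a G ⇔ (a ≡ replicate 9 false))
lemma3p7 = straightLineEmbedding G drawingOfG
         , satisfies⇔≡ (from-yes (satisfies? (replicate 9 false) G)) onlyModelOfG
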